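{- Let $r,t\in\mathbb{N}$, let $G$ be a $K_{t,t}$-free graph and let $k=\operatorname{fw}_{3r}(G)$. Then flipper has a winning strategy in the flipper game of radius $r$ on $G$ in which, in each round, the graph announced by flipper is obtained from $G$ by isolating (removing all incident edges of) at most $kt^2$ vertices of $G$.
   Context: Graphs are finite, simple, undirected; $K_{t,t}$-free means no subgraph isomorphic to $K_{t,t}$. Flipping $(A,B)$ in $G$ yields the graph on $V(G)$ with edge set (on distinct pairs) $E(G)\triangle\{ab:a\in A,b\in B\}$; a $k$-flip of $G$ is obtained by flipping some pairs $(A,B)$ with $A,B\in\mathcal{P}$ (possibly $A=B$) for a partition $\mathcal{P}$ of $V(G)$ with $|\mathcal{P}|\le k$. Flipper game of radius $r\in\mathbb{N}\cup\{\infty\}$ on $G$ between flipper and runner: initially $G_0=G$ and runner chooses $v_0\in V(G)$. In round $i>0$, flipper announces a graph $G_i$ on $V(G)$ (in the game of width $k$, $G_i$ must be a $k$-flip of $G$); then runner, knowing $G_i$, moves to a vertex $v_i$ reachable from $v_{i-1}$ by a path of length at most $r$ in the previous graph $G_{i-1}$. Flipper wins when $v_i$ is isolated in $G_i$. The radius-$r$ flip-width $\operatorname{fw}_r(G)$ is the least $k$ such that flipper has a winning strategy in the game of radius $r$ and width $k$. -}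

module Defs where

open import Data.Nat using (ℕ; zero; suc; _≤_; _<_)
open import Data.Bool using (Bool; true; false; _∧_; _∨_; not; _xor_)
open import Data.Fin using (Fin; _≟_)
open import Data.Fin.Subset using (Subset; ∣_∣)
open import Data.Vec using (lookup)
open import Data.List using (List; []; _∷_)
open import Data.Product using (Σ; _×_; _,_)
open import Data.Sum using (_⊎_; inj₁; inj₂)
open import Relation.Binary.PropositionalEquality using (_≡_)
open import Relation.Nullary using (¬_)
open import Relation.Nullary.Decidable using (⌊_⌋)
open import Function.Definitions using (Injective)

record Graph (n : ℕ) : Set where
  field
    adj    : Fin n → Fin n → Bool
    sym    : ∀ u v → adj u v ≡ adj v u
    irrefl : ∀ v → adj v v ≡ false
open Graph public

KttFree : ∀ {n} → ℕ → Graph n → Set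
KttFree {n} t G =
  ¬ Σ (Fin t ⊎ Fin t → Fin n) λ f →
      Injective _≡_ _≡_ f × (∀ i j → adj G (f (inj₁ i)) (f (inj₂ j)) ≡ true)

-- Flipping: a partition of V(G) into at most k parts is a labelling
-- p : Fin n → Fin k (the parts are the nonempty fibres).
inPair : ∀ {n k} → (Fin n → Fin k) → Fin k × Fin k → Fin n → Fin n → Bool
inPair p (A , B) u v =
  (⌊ p u ≟ A ⌋ ∧ ⌊ p v ≟ B ⌋) ∨ (⌊ p u ≟ B ⌋ ∧ ⌊ p v ≟ A ⌋)

flipAdj : ∀ {n k} → Graph n → (Fin n → Fin k) → List (Fin k × Fin k) →
          Fin n → Fin n → Bool
flipAdj G p []        u v = adj G u v
flipAdj G p (AB ∷ L)  u v = flipAdj G p L u v xor inPair p AB u v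

IsKFlip : ∀ {n} → Graph n → ℕ → Graph n → Set
IsKFlip {n} G k H =
  Σ (Fin n → Fin k) λ p → Σ (List (Fin k × Fin k)) λ L →
    ∀ u v → ¬ (u ≡ v) → adj H u v ≡ flipAdj G p L u v

IsIsolation : ∀ {n} → Graph n → ℕ → Graph n → Set
IsIsolation {n} G m H =
  Σ (Subset n) λ S → (∣ S ∣ ≤ m) ×
    (∀ u v → adj H u v ≡ (adj G u v ∧ (not (lookup S u) ∧ not (lookup S v))))

data Reach {n} (H : Graph n) : ℕ → Fin n → Fin n → Set where
  here : ∀ {r v} → Reach H r v v
  step : ∀ {r u w v} → adj H u w ≡ true → Reach H r w v → Reach H (suc r) u v

Isolated : ∀ {n} → Graph n → Fin n → Set
Isolated H v = ∀ w → adj H v w ≡ false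

-- Flipper game of radius r in which the graphs flipper may announce are
-- those satisfying Allowed.  FlipperWinsFrom Allowed r H v : flipper has a
-- winning strategy from the position where the previous graph is H and
-- runner stands at v.  Being inductive,
-- this expresses winning in finitely many rounds.
data FlipperWinsFrom {n} (Allowed : Graph n → Set) (r : ℕ) :
       Graph n → Fin n → Set where
  win : ∀ {H v} (H' : Graph n) → Allowed H' →
        (∀ v' → Reach H r v v' → Isolated H' v' ⊎ FlipperWinsFrom Allowed r H' v') →
        FlipperWinsFrom Allowed r H v

FlipperWins : ∀ {n} → (Graph n → Set) → ℕ → Graph n → Set
FlipperWins Allowed r G = ∀ v₀ → FlipperWinsFrom Allowed r G v₀

IsFlipWidth : ∀ {n} → ℕ → Graph n → ℕ → Set
IsFlipWidth r G k =
  FlipperWins (IsKFlip G k) r G ×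
  (∀ k′ → k′ < k → ¬ FlipperWins (IsKFlip G k′) r G)

-- For each part P
-- isolate all of P if |P| < t², and otherwise the fewer than t vertices
-- having fewer than t non-neighbours in P (t such vertices would have t
-- common neighbours in P, a K_{t,t}); at most k t² vertices are isolated.
-- If uw is an edge of G between non-isolated vertices, either the parts of
-- u and w are not flipped and uw is an edge of H, or u has t non-neighbours
-- x in w's part and w has t non-neighbours y in u's part; by K_{t,t}-freeness
-- some such x, y are non-adjacent, and u x y w is a path of H.  So every
-- radius-r move in the isolation graph is a radius-3r move in H, and flipper
-- replays a winning flip strategy of radius 3r, spending one extra round to
-- isolate runner's final vertex.
module Submission where

open import Defs hiding (sym)
open import Data.Bool using (Bool; true; false; not; _∧_; _∨_; _xor_)
open import Data.Bool.Properties using (¬-not; xor-assoc; ∨-comm; ∧-comm; ∧-zeroʳ)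
  renaming (_≟_ to _≟ᵇ_)
open import Data.Fin using (Fin; zero; suc; _≟_)
open import Data.Fin.Properties using (suc-injective; any?; all?)
open import Data.Fin.Subset
  using (Subset; inside; outside; ∣_∣; _∈_; _∉_; _⊆_; _∪_; ⊥; ⁅_⁆)
open import Data.Fin.Subset.Properties
  using (∣⊥∣≡0; p⊆p∪q; q⊆p∪q; p⊆q⇒∣p∣≤∣q∣; x∈⁅x⁆; ∣⁅x⁆∣≡1)
open import Data.List using (List; []; _∷_)
open import Data.Nat using (ℕ; zero; suc; pred; _+_; _*_; _≤_; _<_; z≤n; s≤s; _<?_)
open import Data.Nat.Properties
  using (≤-trans; ≤-reflexive; <⇒≤; ≰⇒>; ≮⇒≥; <⇒≤pred; +-suc; +-mono-≤;
         +-monoʳ-≤; +-cancelʳ-≤; *-suc; *-comm; *-mono-≤; m≤m*n; m≤n*m; n≤1+n; m≤n+m;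
         module ≤-Reasoning)
open import Data.Product using (Σ; ∃₂; _×_; _,_)
open import Data.Sum using (inj₁; inj₂; [_,_]; _⊎_)
open import Data.Vec using (_∷_; []; lookup; tabulate; here; there)
open import Data.Vec.Properties using (lookup∘tabulate; []=⇒lookup; lookup⇒[]=)
open import Function using (id; _∘_)
open import Function.Definitions using (Injective)
open import Relation.Binary.PropositionalEquality
  using (_≡_; _≢_; refl; sym; trans; cong; cong₂; subst)
open import Relation.Nullary using (Dec; yes; no; does; contradiction)
open import Relation.Nullary.Decidable using (dec-true; _×-dec_; ⌊_⌋)
open import Relation.Unary using (Pred; Decidable)

subset : ∀ {n ℓ} {P : Pred (Fin n) ℓ} → Decidable P → Subset n
subset P? = tabulate (does ∘ P?)

∈-subset⁺ : ∀ {n ℓ} {P : Pred (Fin n) ℓ} (P? : Decidable P) {x} → P x → x ∈ subset P?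
∈-subset⁺ P? {x} px = lookup⇒[]= x _ (trans (lookup∘tabulate _ x) (dec-true (P? x) px))

∈-subset⁻ : ∀ {n ℓ} {P : Pred (Fin n) ℓ} (P? : Decidable P) {x} → x ∈ subset P? → P x
∈-subset⁻ P? {x} x∈ with P? x | trans (sym (lookup∘tabulate _ x)) ([]=⇒lookup x∈)
... | yes px | _ = px
... | no _   | ()

⋃ᶠ : ∀ {m n} → (Fin m → Subset n) → Subset n
⋃ᶠ {zero}  P = ⊥
⋃ᶠ {suc m} P = P zero ∪ ⋃ᶠ (P ∘ suc)

⊆-⋃ᶠ : ∀ {m n} (P : Fin m → Subset n) i → P i ⊆ ⋃ᶠ P
⊆-⋃ᶠ P zero    = p⊆p∪q _
⊆-⋃ᶠ P (suc i) = q⊆p∪q (P zero) _ ∘ ⊆-⋃ᶠ (P ∘ suc) i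

∣p∪q∣≤∣p∣+∣q∣ : ∀ {n} (p q : Subset n) → ∣ p ∪ q ∣ ≤ ∣ p ∣ + ∣ q ∣
∣p∪q∣≤∣p∣+∣q∣ []            []            = z≤n
∣p∪q∣≤∣p∣+∣q∣ (inside ∷ p)  (inside ∷ q)  =
  s≤s (≤-trans (∣p∪q∣≤∣p∣+∣q∣ p q) (+-monoʳ-≤ ∣ p ∣ (n≤1+n ∣ q ∣)))
∣p∪q∣≤∣p∣+∣q∣ (inside ∷ p)  (outside ∷ q) = s≤s (∣p∪q∣≤∣p∣+∣q∣ p q)
∣p∪q∣≤∣p∣+∣q∣ (outside ∷ p) (inside ∷ q)  =
  ≤-trans (s≤s (∣p∪q∣≤∣p∣+∣q∣ p q)) (≤-reflexive (sym (+-suc ∣ p ∣ ∣ q ∣)))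
∣p∪q∣≤∣p∣+∣q∣ (outside ∷ p) (outside ∷ q) = ∣p∪q∣≤∣p∣+∣q∣ p q

∣⋃ᶠ∣≤ : ∀ {m n c} (P : Fin m → Subset n) → (∀ i → ∣ P i ∣ ≤ c) → ∣ ⋃ᶠ P ∣ ≤ m * c
∣⋃ᶠ∣≤ {zero}  {n} P bound = ≤-reflexive (∣⊥∣≡0 n)
∣⋃ᶠ∣≤ {suc m}     P bound =
  ≤-trans (∣p∪q∣≤∣p∣+∣q∣ (P zero) _) (+-mono-≤ (bound zero) (∣⋃ᶠ∣≤ (P ∘ suc) (bound ∘ suc)))

choose : ∀ {n t} (p : Subset n) → t ≤ ∣ p ∣ →
         Σ (Fin t → Fin n) λ f → Injective _≡_ _≡_ f × (∀ i → f i ∈ p)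
choose {t = zero}  p             _        = (λ ()) , (λ { {()} }) , λ ()
choose {t = suc t} (inside ∷ p)  (s≤s t≤) with choose p t≤
... | f , f-inj , f∈ = g , g-inj , g∈
  where
  g : Fin (suc t) → Fin _
  g zero    = zero
  g (suc i) = suc (f i)
  g-inj : Injective _≡_ _≡_ g
  g-inj {zero}  {zero}  _ = refl
  g-inj {suc i} {suc j} e = cong suc (f-inj (suc-injective e))
  g∈ : ∀ i → g i ∈ inside ∷ p
  g∈ zero    = here
  g∈ (suc i) = there (f∈ i)
choose {t = suc t} (outside ∷ p) t≤       with choose p t≤
... | f , f-inj , f∈ = suc ∘ f , f-inj ∘ suc-injective , there ∘ f∈

m*m≤n+m*pred[m]⇒m≤n : ∀ m n → m * m ≤ n + m * pred m → m ≤ n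
m*m≤n+m*pred[m]⇒m≤n zero    n _  = z≤n
m*m≤n+m*pred[m]⇒m≤n (suc m) n le =
  +-cancelʳ-≤ (suc m * m) (suc m) n (subst (_≤ n + suc m * m) (*-suc (suc m) m) le)

m<n⇒m≤n*n : ∀ {m n} → m < n → m ≤ n * n
m<n⇒m≤n*n {n = suc n} m<n = ≤-trans (<⇒≤ m<n) (m≤m*n (suc n) (suc n))

adj⇒≢ : ∀ {n} (G : Graph n) {u v} → adj G u v ≡ true → u ≢ v
adj⇒≢ G {u} uv refl = contradiction (trans (sym uv) (irrefl G u)) λ ()

nonadjacent-pair : ∀ {n t} (G : Graph n) → KttFree t G →
                   (f g : Fin t → Fin n) → Injective _≡_ _≡_ f → Injective _≡_ _≡_ g →
                   ∃₂ λ i j → adj G (f i) (g j) ≡ false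
nonadjacent-pair G free f g f-inj g-inj
  with any? (λ i → any? (λ j → adj G (f i) (g j) ≟ᵇ false))
... | yes (i , j , fg) = i , j , fg
... | no ∄ = contradiction ([ f , g ] , (λ {x} {y} → f⊎g-inj {x} {y}) , complete) free
  where
  complete : ∀ i j → adj G (f i) (g j) ≡ true
  complete i j = ¬-not λ fg → ∄ (i , j , fg)
  -- the two sides are disjoint because G has no loops
  f⊎g-inj : Injective _≡_ _≡_ [ f , g ]
  f⊎g-inj {inj₁ i} {inj₁ i′} e = cong inj₁ (f-inj e)
  f⊎g-inj {inj₂ j} {inj₂ j′} e = cong inj₂ (g-inj e)
  f⊎g-inj {inj₁ i} {inj₂ j}  e = contradiction e (adj⇒≢ G (complete i j))
  f⊎g-inj {inj₂ j} {inj₁ i}  e = contradiction (sym e) (adj⇒≢ G (complete i j))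

module _ {n} {H : Graph n} where

  Reach-mono : ∀ {a b u v} → a ≤ b → Reach H a u v → Reach H b u v
  Reach-mono _         here         = here
  Reach-mono (s≤s a≤b) (step uw wv) = step uw (Reach-mono a≤b wv)

  Reach-++ : ∀ {a b u v w} → Reach H a u v → Reach H b v w → Reach H (a + b) u w
  Reach-++ {a} {b} here         vw = Reach-mono (m≤n+m b a) vw
  Reach-++         (step uw′ w′v) vw = step uw′ (Reach-++ w′v vw)

  Reach-from-isolated : ∀ {r v w} → Isolated H v → Reach H r v w → w ≡ v
  Reach-from-isolated iso here                = refl
  Reach-from-isolated iso (step {w = w} vw _) = contradiction (trans (sym vw) (iso w)) λ ()

Reach-map : ∀ {n} {K H : Graph n} {c} → (∀ {u w} → adj K u w ≡ true → Reach H c u w) →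
            ∀ {r u v} → Reach K r u v → Reach H (r * c) u v
Reach-map edge here         = here
Reach-map edge (step uw wv) = Reach-++ (edge uw) (Reach-map edge wv)

isolate : ∀ {n} → Graph n → Subset n → Graph n
isolate G S = record
  { adj    = λ u v → adj G u v ∧ (not (lookup S u) ∧ not (lookup S v))
  ; sym    = λ u v → cong₂ _∧_ (Graph.sym G u v) (∧-comm (not (lookup S u)) _)
  ; irrefl = λ v → cong (_∧ _) (irrefl G v)
  }

isolate-isIsolation : ∀ {n m} (G : Graph n) S → ∣ S ∣ ≤ m → IsIsolation G m (isolate G S)
isolate-isIsolation G S ∣S∣≤m = S , ∣S∣≤m , λ _ _ → refl

isolate-isolates : ∀ {n} (G : Graph n) {S v} → v ∈ S → Isolated (isolate G S) v
isolate-isolates G {S} {v} v∈S w rewrite []=⇒lookup v∈S = ∧-zeroʳ (adj G v w)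

isolate-edge : ∀ {n} (G : Graph n) {S u w} → adj (isolate G S) u w ≡ true →
               adj G u w ≡ true × u ∉ S × w ∉ S
isolate-edge G {S} {u} {w} e with adj G u w | lookup S u in Su | lookup S w in Sw
... | true | false | false = refl , ∉-of Su , ∉-of Sw
  where
  ∉-of : ∀ {x} → lookup S x ≡ false → x ∉ S
  ∉-of Sx x∈S = contradiction (trans (sym ([]=⇒lookup x∈S)) Sx) λ ()

flipped : ∀ {k} → List (Fin k × Fin k) → Fin k → Fin k → Bool
flipped []       a b = false
flipped (AB ∷ L) a b = flipped L a b xor inPair id AB a b

flipped-sym : ∀ {k} (L : List (Fin k × Fin k)) a b → flipped L a b ≡ flipped L b a
flipped-sym []             a b = refl
flipped-sym ((A , B) ∷ L) a b = cong₂ _xor_ (flipped-sym L a b)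
  (trans (∨-comm (⌊ a ≟ A ⌋ ∧ ⌊ b ≟ B ⌋) _)
         (cong₂ _∨_ (∧-comm ⌊ a ≟ B ⌋ _) (∧-comm ⌊ a ≟ A ⌋ _)))

flipAdj-xor : ∀ {n k} (G : Graph n) (p : Fin n → Fin k) L u v →
              flipAdj G p L u v ≡ adj G u v xor flipped L (p u) (p v)
flipAdj-xor G p []       u v with adj G u v
... | true  = refl
... | false = refl
flipAdj-xor G p (AB ∷ L) u v =
  trans (cong (_xor inPair p AB u v) (flipAdj-xor G p L u v)) (xor-assoc (adj G u v) _ _)

module Shortcut {n k t} (G : Graph n) {H : Graph n} (free : KttFree t G)
                (p : Fin n → Fin k) (L : List (Fin k × Fin k))
                (H-flip : ∀ u v → u ≢ v → adj H u v ≡ flipAdj G p L u v) where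

  part? : ∀ j → Decidable (λ v → p v ≡ j)
  part? j v = p v ≟ j

  part : Fin k → Subset n
  part j = subset (part? j)

  nonNbr? : ∀ j u → Decidable (λ x → p x ≡ j × adj G u x ≡ false)
  nonNbr? j u x = p x ≟ j ×-dec adj G u x ≟ᵇ false

  nonNbrs : Fin k → Fin n → Subset n
  nonNbrs j u = subset (nonNbr? j u)

  fewNonNbrs? : ∀ j → Decidable (λ u → ∣ nonNbrs j u ∣ < t)
  fewNonNbrs? j u = ∣ nonNbrs j u ∣ <? t

  fewNonNbrs : Fin k → Subset n
  fewNonNbrs j = subset (fewNonNbrs? j)

  commonNbr? : (T : Fin t → Fin n) → Decidable (λ y → ∀ i → adj G (T i) y ≡ true)
  commonNbr? T y = all? (λ i → adj G (T i) y ≟ᵇ true)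

  commonNbrs : (Fin t → Fin n) → Subset n
  commonNbrs T = subset (commonNbr? T)

  -- Every vertex of the part is a common neighbour of T or a non-neighbour of
  -- some T i, and there are at most t (t - 1) of the latter.
  t≤∣commonNbrs∣ : ∀ j (T : Fin t → Fin n) → (∀ i → T i ∈ fewNonNbrs j) →
                   t * t ≤ ∣ part j ∣ → t ≤ ∣ commonNbrs T ∣
  t≤∣commonNbrs∣ j T T∈ large = m*m≤n+m*pred[m]⇒m≤n t ∣ commonNbrs T ∣ (begin
    t * t                                ≤⟨ large ⟩
    ∣ part j ∣                            ≤⟨ p⊆q⇒∣p∣≤∣q∣ cover ⟩
    ∣ commonNbrs T ∪ ⋃ᶠ nonNbrsT ∣         ≤⟨ ∣p∪q∣≤∣p∣+∣q∣ (commonNbrs T) _ ⟩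
    ∣ commonNbrs T ∣ + ∣ ⋃ᶠ nonNbrsT ∣     ≤⟨ +-monoʳ-≤ ∣ commonNbrs T ∣ (∣⋃ᶠ∣≤ nonNbrsT ∣nonNbrsT∣≤) ⟩
    ∣ commonNbrs T ∣ + t * pred t         ∎)
    where
    open ≤-Reasoning

    nonNbrsT : Fin t → Subset n
    nonNbrsT i = nonNbrs j (T i)

    ∣nonNbrsT∣≤ : ∀ i → ∣ nonNbrsT i ∣ ≤ pred t
    ∣nonNbrsT∣≤ i = <⇒≤pred (∈-subset⁻ (fewNonNbrs? j) (T∈ i))

    cover : part j ⊆ commonNbrs T ∪ ⋃ᶠ nonNbrsT
    cover {y} y∈ with any? (λ i → adj G (T i) y ≟ᵇ false)
    ... | yes (i , Ty) = q⊆p∪q (commonNbrs T) _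
                           (⊆-⋃ᶠ nonNbrsT i (∈-subset⁺ (nonNbr? j (T i)) (∈-subset⁻ (part? j) y∈ , Ty)))
    ... | no ∄ = p⊆p∪q _ (∈-subset⁺ (commonNbr? T) λ i → ¬-not λ Ty → ∄ (i , Ty))

  ∣fewNonNbrs∣<t : ∀ j → t * t ≤ ∣ part j ∣ → ∣ fewNonNbrs j ∣ < t
  ∣fewNonNbrs∣<t j large = ≰⇒> λ t≤few →
    let T , T-inj , T∈ = choose (fewNonNbrs j) t≤few
        D , D-inj , D∈ = choose (commonNbrs T) (t≤∣commonNbrs∣ j T T∈ large)
        i , i′ , TD    = nonadjacent-pair G free T D T-inj D-inj
    in contradiction (trans (sym TD) (∈-subset⁻ (commonNbr? T) (D∈ i′) i)) λ ()

  removedBy : ∀ j → Dec (∣ part j ∣ < t * t) → Subset n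
  removedBy j (yes _) = part j
  removedBy j (no _)  = fewNonNbrs j

  removed : Fin k → Subset n
  removed j = removedBy j (∣ part j ∣ <? t * t)

  S : Subset n
  S = ⋃ᶠ removed

  ∣S∣≤ : ∣ S ∣ ≤ k * (t * t)
  ∣S∣≤ = ∣⋃ᶠ∣≤ removed λ j → ∣removedBy∣≤ j (∣ part j ∣ <? t * t)
    where
    ∣removedBy∣≤ : ∀ j small? → ∣ removedBy j small? ∣ ≤ t * t
    ∣removedBy∣≤ j (yes small) = <⇒≤ small
    ∣removedBy∣≤ j (no large)  = m<n⇒m≤n*n (∣fewNonNbrs∣<t j (≮⇒≥ large))

  t≤∣nonNbrs∣ : ∀ {u w} → u ∉ S → w ∉ S → t ≤ ∣ nonNbrs (p w) u ∣
  t≤∣nonNbrs∣ {u} {w} u∉S w∉S =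
    go (∣ part (p w) ∣ <? t * t) (u∉S ∘ ⊆-⋃ᶠ removed (p w)) (w∉S ∘ ⊆-⋃ᶠ removed (p w))
    where
    go : ∀ small? → u ∉ removedBy (p w) small? → w ∉ removedBy (p w) small? →
         t ≤ ∣ nonNbrs (p w) u ∣
    go (yes _) _   w∉ = contradiction (∈-subset⁺ (part? (p w)) refl) w∉
    go (no _)  u∉ _   = ≮⇒≥ (u∉ ∘ ∈-subset⁺ (fewNonNbrs? (p w)))

  hop : ∀ {r a b} → adj G a b xor flipped L (p a) (p b) ≡ true → Reach H (suc r) a b
  hop {a = a} {b} ab with a ≟ b
  ... | yes refl = here
  ... | no a≢b   = step (trans (H-flip a b a≢b) (trans (flipAdj-xor G p L a b) ab)) here

  flipped-shortcut : ∀ {u w} → u ∉ S → w ∉ S → flipped L (p u) (p w) ≡ true → Reach H 3 u w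
  flipped-shortcut {u} {w} u∉S w∉S uw-flipped =
    let f , f-inj , f∈ = choose (nonNbrs (p w) u) (t≤∣nonNbrs∣ u∉S w∉S)
        g , g-inj , g∈ = choose (nonNbrs (p u) w) (t≤∣nonNbrs∣ w∉S u∉S)
        i , j , xy     = nonadjacent-pair G free f g f-inj g-inj
        px , ux        = ∈-subset⁻ (nonNbr? (p w) u) (f∈ i)
        py , wy        = ∈-subset⁻ (nonNbr? (p u) w) (g∈ j)
        fl : ∀ {a b} → p a ≡ p u → p b ≡ p w → flipped L (p a) (p b) ≡ true
        fl pa pb = trans (cong₂ (flipped L) pa pb) uw-flipped
    in Reach-++ (hop {0} (cong₂ _xor_ ux (fl refl px)))
      (Reach-++ (hop {0} (cong₂ _xor_ xy (trans (flipped-sym L _ _) (fl py px))))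
                (hop {0} (cong₂ _xor_ (trans (Graph.sym G _ w) wy) (fl py refl))))

  edge-shortcut : ∀ {u w} → u ∉ S → w ∉ S → adj G u w ≡ true → Reach H 3 u w
  edge-shortcut {u} {w} u∉S w∉S uw with flipped L (p u) (p w) in uw-flipped
  ... | false = hop (cong₂ _xor_ uw uw-flipped)
  ... | true  = flipped-shortcut u∉S w∉S uw-flipped

  Reach-isolate : ∀ {r u v} → Reach (isolate G S) r u v → Reach H (3 * r) u v
  Reach-isolate {r} {u} {v} =
    subst (λ m → Reach H m u v) (*-comm r 3) ∘ Reach-map λ uw →
      let uw , u∉S , w∉S = isolate-edge G uw in edge-shortcut u∉S w∉S uw

shortcut : ∀ {n k t r} (G : Graph n) {H} → KttFree t G → IsKFlip G k H →
           Σ (Graph n) λ K → IsIsolation G (k * (t * t)) K ×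
                             (∀ {u v} → Reach K r u v → Reach H (3 * r) u v)
shortcut G free (p , L , H-flip) =
  isolate G S , isolate-isIsolation G S ∣S∣≤ , Reach-isolate
  where open Shortcut G free p L H-flip

module Transfer {n} {Allowed Allowed′ : Graph n → Set} {r r′ : ℕ}
  (simulate : ∀ {H} → Allowed H →
              Σ (Graph n) λ H′ → Allowed′ H′ × (∀ {u v} → Reach H′ r′ u v → Reach H r u v))
  (isolating : ∀ v → Σ (Graph n) λ H′ → Allowed′ H′ × Isolated H′ v) where

  mutual
    transfer : ∀ {H H′ v} → FlipperWinsFrom Allowed r H v →
               (∀ {w} → Reach H′ r′ v w → Reach H r v w) → FlipperWinsFrom Allowed′ r′ H′ v
    transfer (win H allowed next) covered =
      let H′ , allowed′ , simulated = simulate allowed in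
      win H′ allowed′ λ w reach → inj₂ (transfer-move simulated (next w (covered reach)))

    -- When the simulated runner is caught, one extra round isolates him.
    transfer-move : ∀ {H H′ v} → (∀ {u w} → Reach H′ r′ u w → Reach H r u w) →
                    Isolated H v ⊎ FlipperWinsFrom Allowed r H v → FlipperWinsFrom Allowed′ r′ H′ v
    transfer-move simulated (inj₂ wins)       = transfer wins simulated
    transfer-move {v = v} simulated (inj₁ iso) =
      let I , allowedI , I-iso = isolating v in
      win I allowedI λ w reach →
        inj₁ (subst (Isolated I) (sym (Reach-from-isolated iso (simulated reach))) I-iso)

KttFree⇒1≤t : ∀ {n t} (G : Graph n) → KttFree t G → 1 ≤ t
KttFree⇒1≤t {t = zero}  G free =
  contradiction ([ (λ ()) , (λ ()) ] , (λ { {inj₁ ()} ; {inj₂ ()} }) , λ ()) free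
KttFree⇒1≤t {t = suc _} G free = s≤s z≤n

FlipperWinsFrom-KFlip⇒1≤k : ∀ {n k r} {G H : Graph n} {v} →
                            FlipperWinsFrom (IsKFlip G k) r H v → 1 ≤ k
FlipperWinsFrom-KFlip⇒1≤k {k = zero}  {v = v} (win _ (p , _) _) with () ← p v
FlipperWinsFrom-KFlip⇒1≤k {k = suc _}         _                  = s≤s z≤n

lemma4p13 : ∀ {n : ℕ} (r t k : ℕ) (G : Graph n) →
    KttFree t G → IsFlipWidth (3 * r) G k →
    FlipperWins (IsIsolation G (k * (t * t))) r G
lemma4p13 r t k G free (flipper-wins , _) v₀ =
  transfer (flipper-wins v₀) (Reach-mono (m≤n*m r 3))
  where
  1≤k*t*t : 1 ≤ k * (t * t)
  1≤k*t*t = *-mono-≤ (FlipperWinsFrom-KFlip⇒1≤k (flipper-wins v₀))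
                     (*-mono-≤ (KttFree⇒1≤t G free) (KttFree⇒1≤t G free))

  isolating : ∀ v → Σ (Graph _) λ I → IsIsolation G (k * (t * t)) I × Isolated I v
  isolating v = isolate G ⁅ v ⁆
              , isolate-isIsolation G ⁅ v ⁆ (subst (_≤ k * (t * t)) (sym (∣⁅x⁆∣≡1 v)) 1≤k*t*t)
              , isolate-isolates G (x∈⁅x⁆ v)

  open Transfer (shortcut {k = k} G free) isolating
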